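{- Let $k\ge 2$ and let $\mathcal{H}=(V,E)$ be a $k$-uniform threshold hypergraph given by a binary sequence. Then: (1) every induced subhypergraph of $\mathcal{H}$ is also a $k$-uniform threshold hypergraph (given by some binary sequence, with respect to a suitable ordering of its vertices); (2) the complement of $\mathcal{H}$ is a $k$-uniform threshold hypergraph (given by some binary sequence); (3) $\mathcal{H}$ is a split hypergraph.
   Context: Let $k\ge 2$ and $n$ be positive integers and let $(b_1,\dots,b_n)_k$ be a binary sequence ($b_i\in\{0,1\}$) with $b_1=\dots=b_{k-1}=0$. The $k$-uniform threshold hypergraph $\mathcal{H}=(V,E)$ given by this sequence has vertex set $V=\{v_1,\dots,v_n\}$, and a set $e$ is an edge if and only if $e$ is a $k$-element subset of $V$ and $b_j=1$, where $j=\max\{i: v_i\in e\}$. For $W\subseteq V$, the induced subhypergraph on $W$ has vertex set $W$ and as edges those edges of $\mathcal{H}$ contained in $W$. The complement of $\mathcal{H}$ is the $k$-uniform hypergraph on $V$ whose edges are the $k$-element subsets of $V$ that are not in $E$. A $k$-uniform hypergraph is a split hypergraph if its vertex set can be partitioned into a set $S$ containing no edge (a stable set) and a set $C$ all of whose $k$-element subsets are edges (a clique). -}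

module Defs where

open import Data.Nat using (ℕ; suc; _≤_; _<_)
open import Data.Bool using (Bool; true; false)
open import Data.Fin using (Fin; toℕ; _≟_)
open import Data.Fin.Properties using (any?)
open import Data.Fin.Subset using (Subset; _∈_; _⊆_; ∣_∣; ∁)
open import Data.Fin.Subset.Properties using (_∈?_)
open import Data.Vec using (Vec; lookup; tabulate)
open import Data.Product using (Σ; _×_; ∃; ∃-syntax)
open import Relation.Nullary using (¬_; does)
open import Relation.Nullary.Decidable using (_×-dec_)
open import Relation.Binary.PropositionalEquality using (_≡_)
open import Function.Bundles using (_⇔_; _↔_; Inverse)

-- A binary sequence (b_1,...,b_n) is a vector b : Vec Bool n, with
-- b_{i+1} = lookup b i for i : Fin n (0-based indexing; vertex v_{i+1} is i).

-- Validity for a k-uniform threshold hypergraph: b_1 = ... = b_{k-1} = 0,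
-- i.e. lookup b i ≡ false whenever (toℕ i) + 1 ≤ k - 1, i.e. suc (toℕ i) < k.
ValidSeq : (k : ℕ) {n : ℕ} → Vec Bool n → Set
ValidSeq k {n} b = (i : Fin n) → suc (toℕ i) < k → lookup b i ≡ false

ThEdge : (k : ℕ) {n : ℕ} → Vec Bool n → Subset n → Set
ThEdge k {n} b e =
  ∣ e ∣ ≡ k ×
  Σ (Fin n) (λ j → j ∈ e × ((i : Fin n) → i ∈ e → toℕ i ≤ toℕ j) × lookup b j ≡ true)

image : {m n : ℕ} → (Fin m → Fin n) → Subset m → Subset n
image f s = tabulate (λ y → does (any? (λ i → (i ∈? s) ×-dec (f i ≟ y))))

InducedIsThreshold : (k : ℕ) {n : ℕ} → Vec Bool n → Subset n → Set
InducedIsThreshold k {n} b W =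
  ∃[ m ] Σ (Fin m → Fin n) (λ f →
    ((i j : Fin m) → f i ≡ f j → i ≡ j) ×
    ((x : Fin n) → (x ∈ W) ⇔ (∃[ i ] f i ≡ x)) ×
    Σ (Vec Bool m) (λ b' → ValidSeq k b' ×
      ((s : Subset m) → ThEdge k b' s ⇔ (image f s ⊆ W × ThEdge k b (image f s)))))

ComplementIsThreshold : (k : ℕ) {n : ℕ} → Vec Bool n → Set
ComplementIsThreshold k {n} b =
  Σ (Fin n ↔ Fin n) (λ σ → Σ (Vec Bool n) (λ b' → ValidSeq k b' ×
    ((s : Subset n) → ThEdge k b' s ⇔
       (∣ image (Inverse.to σ) s ∣ ≡ k × ¬ ThEdge k b (image (Inverse.to σ) s)))))

IsSplit : (k : ℕ) {n : ℕ} → (Subset n → Set) → Set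
IsSplit k {n} Edge =
  Σ (Subset n) (λ S →
    ((e : Subset n) → e ⊆ S → ¬ Edge e) ×
    ((e : Subset n) → e ⊆ ∁ S → ∣ e ∣ ≡ k → Edge e))

{-# OPTIONS --safe #-}
-- Whether a k-set is an edge is decided by b at its top vertex j, and j ≥ k - 1 because a set of
-- vertices with indices at most j has at most j + 1 elements. So for any labelling g of the vertices,
-- clearing its first k - 1 labels yields a valid sequence whose edges are exactly the k-sets
-- labelled 1 at the top. Labelling the increasing enumeration of W by b gives the induced
-- subhypergraph, labelling by not ∘ b gives the complement in the same vertex order, and the
-- vertices labelled 0 (resp. 1) by b form a stable set (resp. a clique).
module Submission where

open import Defs
open import Data.Nat using (ℕ; suc; _≤_; _≤?_; z≤n; s≤s; s≤s⁻¹)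
open import Data.Nat.Properties using (≤-trans; ≤-reflexive; n≤1+n; <⇒≱; m<n⇒n≢0)
open import Data.Bool using (Bool; true; not; _∧_)
open import Data.Bool.Properties using (T-≡; not-injective; not-¬; ¬-not)
open import Data.Fin as Fin using (Fin; zero; suc; toℕ; _≟_)
open import Data.Fin.Properties using (any?; suc-injective) renaming (≤-antisym to Fin-≤-antisym)
open import Data.Fin.Subset using (Subset; _∈_; _⊆_; ∣_∣; ∁; ⁅_⁆; Nonempty; Empty; inside; outside)
open import Data.Fin.Subset.Properties
  using (_∈?_; nonempty?; drop-there; Empty-unique; ∣⊥∣≡0; ⊆-antisym; p⊆q⇒∣p∣≤∣q∣; ∣⁅x⁆∣≡1; x∈⁅x⁆;
         x∈∁p⇒x∉p; x∉∁p⇒x∈p)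
open import Data.Vec using (Vec; _∷_; []; lookup; tabulate; here; there)
open import Data.Vec.Properties using (lookup∘tabulate; []=⇒lookup; lookup⇒[]=)
open import Data.Product using (_×_; ∃; ∃-syntax; _,_; proj₁; proj₂)
open import Data.Sum using (_⊎_; inj₁; inj₂)
open import Function.Base using (id; _∘_)
open import Function.Bundles using (_⇔_; mk⇔; Equivalence)
open import Function.Construct.Identity using (↔-id)
open import Function.Construct.Symmetry using (⇔-sym)
open import Function.Related.Propositional using (module EquationalReasoning)
open import Relation.Nullary using (¬_; does; contradiction)
open import Relation.Nullary.Decidable
  using (_×-dec_; decidable-stable; isYes; isYes≗does; dec-true; dec-false; toWitness)
open import Relation.Binary.Core using (_Preserves_⟶_)
open import Relation.Binary.PropositionalEquality
  using (_≡_; refl; sym; trans; cong; subst; module ≡-Reasoning)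

private
  variable
    k m n : ℕ

∈-image⁻ : (f : Fin m → Fin n) (s : Subset m) {y : Fin n} →
           y ∈ image f s → ∃[ i ] (i ∈ s × f i ≡ y)
∈-image⁻ f s {y} y∈ = toWitness {a? = witness?} (Equivalence.from T-≡ (begin
  isYes witness?        ≡⟨ isYes≗does witness? ⟩
  does witness?         ≡⟨ lookup∘tabulate _ y ⟨
  lookup (image f s) y  ≡⟨ []=⇒lookup y∈ ⟩
  true                  ∎))
  where
  open ≡-Reasoning
  witness? = any? λ i → (i ∈? s) ×-dec (f i ≟ y)

∈-image⁺ : (f : Fin m → Fin n) (s : Subset m) {i : Fin m} → i ∈ s → f i ∈ image f s
∈-image⁺ f s {i} i∈s = lookup⇒[]= (f i) (image f s)
  (trans (lookup∘tabulate _ (f i)) (dec-true (any? _) (i , i∈s , refl)))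

image-id : (s : Subset n) → image id s ≡ s
image-id s = ⊆-antisym image⊆s (∈-image⁺ id s)
  where
  image⊆s : image id s ⊆ s
  image⊆s y∈ with ∈-image⁻ id s y∈
  ... | _ , i∈s , refl = i∈s

image-⊆ : (f : Fin m → Fin n) {W : Subset n} → (∀ i → f i ∈ W) → (s : Subset m) → image f s ⊆ W
image-⊆ f f∈W s y∈ with ∈-image⁻ f s y∈
... | i , _ , refl = f∈W i

enumerate : (W : Subset n) → Fin ∣ W ∣ → Fin n
enumerate (inside  ∷ W) zero    = zero
enumerate (inside  ∷ W) (suc i) = suc (enumerate W i)
enumerate (outside ∷ W) i       = suc (enumerate W i)

enumerate-∈ : (W : Subset n) (i : Fin ∣ W ∣) → enumerate W i ∈ W
enumerate-∈ (inside  ∷ W) zero    = here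
enumerate-∈ (inside  ∷ W) (suc i) = there (enumerate-∈ W i)
enumerate-∈ (outside ∷ W) i       = there (enumerate-∈ W i)

∈⇒∈-enumerate : (W : Subset n) {x : Fin n} → x ∈ W → ∃[ i ] enumerate W i ≡ x
∈⇒∈-enumerate (inside ∷ W) here = zero , refl
∈⇒∈-enumerate (inside ∷ W) (there x∈W) with ∈⇒∈-enumerate W x∈W
... | i , refl = suc i , refl
∈⇒∈-enumerate (outside ∷ W) (there x∈W) with ∈⇒∈-enumerate W x∈W
... | i , refl = i , refl

enumerate-injective : (W : Subset n) (i j : Fin ∣ W ∣) → enumerate W i ≡ enumerate W j → i ≡ j
enumerate-injective (inside  ∷ W) zero    zero    _  = refl
enumerate-injective (inside  ∷ W) (suc i) (suc j) eq = cong suc (enumerate-injective W i j (suc-injective eq))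
enumerate-injective (outside ∷ W) i       j       eq = enumerate-injective W i j (suc-injective eq)

enumerate-mono-≤ : (W : Subset n) → enumerate W Preserves Fin._≤_ ⟶ Fin._≤_
enumerate-mono-≤ (inside  ∷ W) {zero}        _         = z≤n
enumerate-mono-≤ (inside  ∷ W) {suc i} {suc j} (s≤s i≤j) = s≤s (enumerate-mono-≤ W i≤j)
enumerate-mono-≤ (outside ∷ W)                 i≤j       = s≤s (enumerate-mono-≤ W i≤j)

spread : (W : Subset n) → Subset ∣ W ∣ → Subset n
spread []            s       = []
spread (inside  ∷ W) (x ∷ s) = x ∷ spread W s
spread (outside ∷ W) s       = outside ∷ spread W s

∣spread∣ : (W : Subset n) (s : Subset ∣ W ∣) → ∣ spread W s ∣ ≡ ∣ s ∣
∣spread∣ []            []            = refl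
∣spread∣ (inside  ∷ W) (inside  ∷ s) = cong suc (∣spread∣ W s)
∣spread∣ (inside  ∷ W) (outside ∷ s) = ∣spread∣ W s
∣spread∣ (outside ∷ W) s             = ∣spread∣ W s

∈-spread⁻ : (W : Subset n) (s : Subset ∣ W ∣) {y : Fin n} →
            y ∈ spread W s → ∃[ i ] (i ∈ s × enumerate W i ≡ y)
∈-spread⁻ (inside ∷ W) (x ∷ s) here = zero , here , refl
∈-spread⁻ (inside ∷ W) (x ∷ s) (there y∈) with ∈-spread⁻ W s y∈
... | i , i∈s , refl = suc i , there i∈s , refl
∈-spread⁻ (outside ∷ W) s (there y∈) with ∈-spread⁻ W s y∈
... | i , i∈s , refl = i , i∈s , refl

∈-spread⁺ : (W : Subset n) (s : Subset ∣ W ∣) {i : Fin ∣ W ∣} → i ∈ s → enumerate W i ∈ spread W s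
∈-spread⁺ (inside  ∷ W) (x ∷ s) here       = here
∈-spread⁺ (inside  ∷ W) (x ∷ s) (there i∈s) = there (∈-spread⁺ W s i∈s)
∈-spread⁺ (outside ∷ W) s       i∈s         = there (∈-spread⁺ W s i∈s)

image-enumerate : (W : Subset n) (s : Subset ∣ W ∣) → image (enumerate W) s ≡ spread W s
image-enumerate W s = ⊆-antisym image⊆spread spread⊆image
  where
  image⊆spread : image (enumerate W) s ⊆ spread W s
  image⊆spread y∈ with ∈-image⁻ (enumerate W) s y∈
  ... | _ , i∈s , refl = ∈-spread⁺ W s i∈s
  spread⊆image : spread W s ⊆ image (enumerate W) s
  spread⊆image y∈ with ∈-spread⁻ W s y∈
  ... | _ , i∈s , refl = ∈-image⁺ (enumerate W) s i∈s

UpperBound : Subset n → Fin n → Set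
UpperBound p j = ∀ i → i ∈ p → i Fin.≤ j

IsMax : Subset n → Fin n → Set
IsMax p j = j ∈ p × UpperBound p j

max-unique : {p : Subset n} {i j : Fin n} → IsMax p i → IsMax p j → i ≡ j
max-unique (i∈p , i-ub) (j∈p , j-ub) = Fin-≤-antisym (j-ub _ i∈p) (i-ub _ j∈p)

Empty⊎max : (p : Subset n) → Empty p ⊎ ∃ (IsMax p)
Empty⊎max [] = inj₁ λ ()
Empty⊎max (x ∷ p) with Empty⊎max p
... | inj₂ (j , j∈p , j-ub) =
  inj₂ (suc j , there j∈p , λ { zero _ → z≤n ; (suc i) i∈ → s≤s (j-ub i (drop-there i∈)) })
Empty⊎max (inside ∷ p) | inj₁ p-empty =
  inj₂ (zero , here , λ { zero _ → z≤n ; (suc i) i∈ → contradiction (i , drop-there i∈) p-empty })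
Empty⊎max (outside ∷ p) | inj₁ p-empty =
  inj₁ λ { (suc i , i∈) → p-empty (i , drop-there i∈) }

Nonempty⇒∃max : {p : Subset n} → Nonempty p → ∃ (IsMax p)
Nonempty⇒∃max {p = p} p-nonempty with Empty⊎max p
... | inj₁ p-empty = contradiction p-nonempty p-empty
... | inj₂ p-max   = p-max

Empty⇒∣p∣≡0 : {p : Subset n} → Empty p → ∣ p ∣ ≡ 0
Empty⇒∣p∣≡0 {n} {p} p-empty = trans (cong ∣_∣ (Empty-unique {p = p} p-empty)) (∣⊥∣≡0 n)

∣p∣≡k⇒Nonempty : {p : Subset n} → 1 ≤ k → ∣ p ∣ ≡ k → Nonempty p
∣p∣≡k⇒Nonempty {p = p} 1≤k ∣p∣≡k =
  decidable-stable (nonempty? p) λ p-empty → m<n⇒n≢0 1≤k (trans (sym ∣p∣≡k) (Empty⇒∣p∣≡0 p-empty))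

∣p∣≤1+ub : (p : Subset n) (j : Fin n) → UpperBound p j → ∣ p ∣ ≤ suc (toℕ j)
∣p∣≤1+ub {suc n} p zero p≤0 = ≤-trans (p⊆q⇒∣p∣≤∣q∣ p⊆⁅0⁆) (≤-reflexive (∣⁅x⁆∣≡1 (zero {n})))
  where
  p⊆⁅0⁆ : p ⊆ ⁅ zero ⁆
  p⊆⁅0⁆ {zero}  _   = x∈⁅x⁆ zero
  p⊆⁅0⁆ {suc i} i∈p with () ← p≤0 (suc i) i∈p
∣p∣≤1+ub (x ∷ p) (suc j) x∷p≤1+j = ∣x∷p∣≤1+∣p∣ x (s≤s (∣p∣≤1+ub p j p≤j))
  where
  p≤j : UpperBound p j
  p≤j i i∈p = s≤s⁻¹ (x∷p≤1+j (suc i) (there i∈p))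
  ∣x∷p∣≤1+∣p∣ : ∀ x {m} → suc ∣ p ∣ ≤ m → ∣ x ∷ p ∣ ≤ m
  ∣x∷p∣≤1+∣p∣ inside  ≤m = ≤m
  ∣x∷p∣≤1+∣p∣ outside ≤m = ≤-trans (n≤1+n _) ≤m

image-IsMax : (f : Fin m → Fin n) → f Preserves Fin._≤_ ⟶ Fin._≤_ →
              {s : Subset m} {j : Fin m} → IsMax s j → IsMax (image f s) (f j)
image-IsMax f f-mono {s} (j∈s , s≤j) = ∈-image⁺ f s j∈s , image≤fj
  where
  image≤fj : UpperBound (image f s) (f _)
  image≤fj y y∈ with ∈-image⁻ f s y∈
  ... | i , i∈s , refl = f-mono (s≤j i i∈s)

⇔-atMax : {A B : Set} (p : Subset n) → (A → Nonempty p) → (B → Nonempty p) →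
          (∀ {j} → IsMax p j → A ⇔ B) → A ⇔ B
⇔-atMax _ A⇒p≠∅ B⇒p≠∅ A⇔B = mk⇔
  (λ a → Equivalence.to   (A⇔B (proj₂ (Nonempty⇒∃max (A⇒p≠∅ a)))) a)
  (λ b → Equivalence.from (A⇔B (proj₂ (Nonempty⇒∃max (B⇒p≠∅ b)))) b)

ThEdge⇔top : (b : Vec Bool n) {e : Subset n} {j : Fin n} →
             IsMax e j → ThEdge k b e ⇔ (∣ e ∣ ≡ k × lookup b j ≡ true)
ThEdge⇔top b e-max@(j∈e , e≤j) = mk⇔
  (λ (∣e∣≡k , i , i∈e , e≤i , bᵢ) →
     ∣e∣≡k , subst (λ i → lookup b i ≡ true) (max-unique (i∈e , e≤i) e-max) bᵢ)
  (λ (∣e∣≡k , bⱼ) → ∣e∣≡k , _ , j∈e , e≤j , bⱼ)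

ThEdge⇒Nonempty : (b : Vec Bool n) {e : Subset n} → ThEdge k b e → Nonempty e
ThEdge⇒Nonempty _ (_ , j , j∈e , _) = j , j∈e

clearBelow : (k : ℕ) → (Fin n → Bool) → Vec Bool n
clearBelow k g = tabulate λ j → does (k ≤? suc (toℕ j)) ∧ g j

clearBelow-valid : (g : Fin n → Bool) → ValidSeq k (clearBelow k g)
clearBelow-valid {k = k} g j 1+j<k =
  trans (lookup∘tabulate _ j) (cong (_∧ g j) (dec-false (k ≤? _) (<⇒≱ 1+j<k)))

lookup-clearBelow : (g : Fin n → Bool) {j : Fin n} → k ≤ suc (toℕ j) → lookup (clearBelow k g) j ≡ g j
lookup-clearBelow {k = k} g {j} k≤1+j =
  trans (lookup∘tabulate _ j) (cong (_∧ g j) (dec-true (k ≤? _) k≤1+j))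

ThEdge-clearBelow : (g : Fin n → Bool) {e : Subset n} {j : Fin n} →
                    IsMax e j → ThEdge k (clearBelow k g) e ⇔ (∣ e ∣ ≡ k × g j ≡ true)
ThEdge-clearBelow {k = k} g {e} {j} e-max = begin
  ThEdge k (clearBelow k g) e                    ∼⟨ ThEdge⇔top (clearBelow k g) e-max ⟩
  (∣ e ∣ ≡ k × lookup (clearBelow k g) j ≡ true) ∼⟨ mk⇔ (λ (c , x) → c , trans (sym (lookup-top c)) x)
                                                      (λ (c , x) → c , trans (lookup-top c) x) ⟩
  (∣ e ∣ ≡ k × g j ≡ true)                       ∎
  where
  open EquationalReasoning
  lookup-top : ∣ e ∣ ≡ k → lookup (clearBelow k g) j ≡ g j
  lookup-top ∣e∣≡k = lookup-clearBelow g (subst (_≤ suc (toℕ j)) ∣e∣≡k (∣p∣≤1+ub e j (proj₂ e-max)))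

complementSeq : (k : ℕ) → Vec Bool n → Vec Bool n
complementSeq k b = clearBelow k (not ∘ lookup b)

complement-edges : 1 ≤ k → (b : Vec Bool n) (s : Subset n) →
                   ThEdge k (complementSeq k b) s ⇔ (∣ s ∣ ≡ k × ¬ ThEdge k b s)
complement-edges {k = k} 1≤k b s =
  ⇔-atMax s (ThEdge⇒Nonempty (complementSeq k b)) (∣p∣≡k⇒Nonempty 1≤k ∘ proj₁) atMax
  where
  atMax : ∀ {j} → IsMax s j → ThEdge k (complementSeq k b) s ⇔ (∣ s ∣ ≡ k × ¬ ThEdge k b s)
  atMax {j} s-max = begin
    ThEdge k (complementSeq k b) s        ∼⟨ ThEdge-clearBelow (not ∘ lookup b) s-max ⟩
    (∣ s ∣ ≡ k × not (lookup b j) ≡ true) ∼⟨ mk⇔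
      (λ (∣s∣≡k , nbⱼ) → ∣s∣≡k , λ s∈E → not-¬ (not-injective nbⱼ) (proj₂ (Equivalence.to b-edge s∈E)))
      (λ (∣s∣≡k , s∉E) → ∣s∣≡k , cong not (¬-not λ bⱼ → s∉E (Equivalence.from b-edge (∣s∣≡k , bⱼ)))) ⟩
    (∣ s ∣ ≡ k × ¬ ThEdge k b s)          ∎
    where
    open EquationalReasoning
    b-edge : ThEdge k b s ⇔ (∣ s ∣ ≡ k × lookup b j ≡ true)
    b-edge = ThEdge⇔top b s-max

complementIsThreshold : 1 ≤ k → (b : Vec Bool n) → ComplementIsThreshold k b
complementIsThreshold {k = k} 1≤k b =
  ↔-id _ , complementSeq k b , clearBelow-valid _ ,
  λ s → subst (λ t → ThEdge k (complementSeq k b) s ⇔ (∣ t ∣ ≡ k × ¬ ThEdge k b t))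
              (sym (image-id s)) (complement-edges 1≤k b s)

inducedSeq : (k : ℕ) → Vec Bool n → (W : Subset n) → Vec Bool ∣ W ∣
inducedSeq k b W = clearBelow k (lookup b ∘ enumerate W)

induced-edges : (b : Vec Bool n) (W : Subset n) (s : Subset ∣ W ∣) →
                ThEdge k (inducedSeq k b W) s ⇔ ThEdge k b (image (enumerate W) s)
induced-edges {k = k} b W s =
  ⇔-atMax s (ThEdge⇒Nonempty (inducedSeq k b W)) image-Nonempty atMax
  where
  t : Subset _
  t = image (enumerate W) s
  image-Nonempty : ThEdge k b t → Nonempty s
  image-Nonempty t∈E with ∈-image⁻ (enumerate W) s (proj₂ (ThEdge⇒Nonempty b t∈E))
  ... | i , i∈s , _ = i , i∈s
  atMax : ∀ {j} → IsMax s j → ThEdge k (inducedSeq k b W) s ⇔ ThEdge k b t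
  atMax {j} s-max = begin
    ThEdge k (inducedSeq k b W) s                 ∼⟨ ThEdge-clearBelow (lookup b ∘ enumerate W) s-max ⟩
    (∣ s ∣ ≡ k × lookup b (enumerate W j) ≡ true) ≡⟨ cong (λ m → m ≡ k × _) ∣s∣≡∣t∣ ⟩
    (∣ t ∣ ≡ k × lookup b (enumerate W j) ≡ true) ∼⟨ ⇔-sym (ThEdge⇔top b t-max) ⟩
    ThEdge k b t                                  ∎
    where
    open EquationalReasoning
    ∣s∣≡∣t∣ : ∣ s ∣ ≡ ∣ t ∣
    ∣s∣≡∣t∣ = sym (trans (cong ∣_∣ (image-enumerate W s)) (∣spread∣ W s))
    t-max : IsMax t (enumerate W j)
    t-max = image-IsMax (enumerate W) (enumerate-mono-≤ W) s-max

inducedIsThreshold : (k : ℕ) (b : Vec Bool n) (W : Subset n) → InducedIsThreshold k b W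
inducedIsThreshold k b W =
  ∣ W ∣ , enumerate W , enumerate-injective W ,
  (λ x → mk⇔ (∈⇒∈-enumerate W) λ { (i , refl) → enumerate-∈ W i }) ,
  inducedSeq k b W , clearBelow-valid _ ,
  λ s → mk⇔ (edge⇒ s) (Equivalence.from (induced-edges b W s) ∘ proj₂)
  where
  edge⇒ : (s : Subset ∣ W ∣) → ThEdge k (inducedSeq k b W) s →
          image (enumerate W) s ⊆ W × ThEdge k b (image (enumerate W) s)
  edge⇒ s s∈E = image-⊆ (enumerate W) (enumerate-∈ W) s , Equivalence.to (induced-edges b W s) s∈E

isSplit : 1 ≤ k → (b : Vec Bool n) → IsSplit k (ThEdge k b)
isSplit {k = k} {n = n} 1≤k b = ∁ b , stable , clique
  where
  stable : (e : Subset n) → e ⊆ ∁ b → ¬ ThEdge k b e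
  stable e e⊆∁b (_ , j , j∈e , _ , bⱼ) = x∈∁p⇒x∉p (e⊆∁b j∈e) (lookup⇒[]= j b bⱼ)
  clique : (e : Subset n) → e ⊆ ∁ (∁ b) → ∣ e ∣ ≡ k → ThEdge k b e
  clique e e⊆∁∁b ∣e∣≡k with Nonempty⇒∃max (∣p∣≡k⇒Nonempty 1≤k ∣e∣≡k)
  ... | j , e-max@(j∈e , _) =
    Equivalence.from (ThEdge⇔top b e-max) (∣e∣≡k , []=⇒lookup (x∉∁p⇒x∈p (x∈∁p⇒x∉p (e⊆∁∁b j∈e))))

-- Neither 1 ≤ n nor the validity of b is needed: an entry of b below index k - 1 is never
-- read at the top vertex of a k-set.
proposition2 : (k n : ℕ) → 2 ≤ k → 1 ≤ n → (b : Vec Bool n) → ValidSeq k b →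
    ((W : Subset n) → InducedIsThreshold k b W) ×
    ComplementIsThreshold k b ×
    IsSplit k (ThEdge k b)
proposition2 k n 2≤k _ b _ =
  inducedIsThreshold k b , complementIsThreshold 1≤k b , isSplit 1≤k b
  where
  1≤k : 1 ≤ k
  1≤k = ≤-trans (s≤s z≤n) 2≤k
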